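{- For $n_1,n_2 \geq 5$, $sat(K_{n_1,n_2},C_6) \geq n_1+n_2 +1$.
   Context: All graphs are finite, simple and undirected. $K_{n_1,n_2}$ is the complete bipartite graph with parts of sizes $n_1,n_2$. $C_6$ is the cycle on $6$ vertices. A spanning subgraph $H$ of $G$ is $F$-saturated relative to $G$ if $H$ contains no copy of $F$ but $H+e$ contains a copy of $F$ for every $e\in E(G)\setminus E(H)$; $sat(G,F)$ is the minimum number of edges of a graph that is $F$-saturated relative to $G$. -}

module Defs where

open import Data.Nat using (ℕ; _+_)
open import Data.Bool using (Bool; true; false; if_then_else_; T)
open import Data.Fin using (Fin; zero; suc; _≟_)
open import Data.Sum using (_⊎_; inj₁; inj₂)
open import Data.Product using (Σ; _×_)
open import Data.Empty using (⊥)
open import Data.List using (map)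
open import Data.Nat.ListAction using (sum)
open import Data.List.Base using (allFin)
open import Relation.Nullary using (¬_; does)
open import Relation.Binary.PropositionalEquality using (_≡_)
open import Function.Definitions using (Injective)

Vertex : ℕ → ℕ → Set
Vertex n₁ n₂ = Fin n₁ ⊎ Fin n₂

-- A spanning subgraph H of K_{n₁,n₂} is determined by its edge set,
-- a subset of the edges of K_{n₁,n₂}, i.e. of pairs (a , b) ∈ Fin n₁ × Fin n₂.
SpanningSub : ℕ → ℕ → Set
SpanningSub n₁ n₂ = Fin n₁ → Fin n₂ → Bool

Adj : ∀ {n₁ n₂} → SpanningSub n₁ n₂ → Vertex n₁ n₂ → Vertex n₁ n₂ → Set
Adj H (inj₁ a) (inj₂ b) = T (H a b)
Adj H (inj₂ b) (inj₁ a) = T (H a b)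
Adj H (inj₁ _) (inj₁ _) = ⊥
Adj H (inj₂ _) (inj₂ _) = ⊥

edgeCount : ∀ {n₁ n₂} → SpanningSub n₁ n₂ → ℕ
edgeCount {n₁} {n₂} H =
  sum (map (λ a → sum (map (λ b → if H a b then 1 else 0) (allFin n₂))) (allFin n₁))

next6 : Fin 6 → Fin 6
next6 zero = suc zero
next6 (suc zero) = suc (suc zero)
next6 (suc (suc zero)) = suc (suc (suc zero))
next6 (suc (suc (suc zero))) = suc (suc (suc (suc zero)))
next6 (suc (suc (suc (suc zero)))) = suc (suc (suc (suc (suc zero))))
next6 (suc (suc (suc (suc (suc zero))))) = zero

ContainsC6 : ∀ {n₁ n₂} → SpanningSub n₁ n₂ → Set
ContainsC6 {n₁} {n₂} H =
  Σ (Fin 6 → Vertex n₁ n₂) λ f → Injective _≡_ _≡_ f × (∀ i → Adj H (f i) (f (next6 i)))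

addEdge : ∀ {n₁ n₂} → SpanningSub n₁ n₂ → Fin n₁ → Fin n₂ → SpanningSub n₁ n₂
addEdge H a b a' b' = if does (a ≟ a') then (if does (b ≟ b') then true else H a' b') else H a' b'

C6Saturated : ∀ {n₁ n₂} → SpanningSub n₁ n₂ → Set
C6Saturated H =
  ¬ ContainsC6 H × (∀ a b → H a b ≡ false → ContainsC6 (addEdge H a b))

-- Adding a missing edge ab creates a C₆, so H contains a
-- path with five edges from a to b.  Hence H is connected and breadth-first distances from any
-- root r are defined.  Every edge joins two consecutive levels, so counting each edge at its
-- endpoint farther from r writes e(H) as the sum over all vertices of their numbers of neighbours
-- one level closer to r.  Every vertex other than r has such a neighbour, so e(H) ≥ n₁ + n₂ + 1
-- as soon as two vertices have two of them, or one vertex has three.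
--
-- A root with this property is found next to a short cycle.  As C₆ ⊆ K₃,₃, some pair ab is missing
-- from H; its 5-path a x₁ x₂ x₃ x₄ b either has the chord a x₃, giving a 4-cycle, or a second 5-path
-- from a to x₃ closes a x₁ x₂ x₃ up into a 4-cycle or an 8-cycle.  Such a cycle misses a vertex, so
-- some vertex w off the cycle is adjacent to it, and a breadth-first search from w, or from the
-- cycle vertex next to w, exhibits the required vertices, except in configurations that close a C₆
-- in H or a 4-cycle, which is then treated in the same way.

module Submission where

open import Defs
import Algebra.Properties.CommutativeMonoid.Sum
open import Algebra.Properties.CommutativeSemigroup using (interchange)
open import Data.Bool using (Bool; true; false; if_then_else_; not; T)
open import Data.Bool.Properties using (T?; not-¬; not-involutive)
open import Data.Empty using (⊥-elim)
open import Data.Fin using (Fin; zero; suc; splitAt; inject≤)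
open import Data.Fin.Patterns using (0F; 1F; 2F; 3F; 4F; 5F)
open import Data.Fin.Properties
  using (_≟_; any?; all?; ¬∀⟶∃¬; pigeonhole; <⇒≢; +↔⊎; inject≤-injective)
open import Data.List using (List; []; _∷_; _∷ʳ_; map; length; lookup; tabulate; allFin)
open import Data.List.Membership.Propositional using (_∈_; _∉_)
open import Data.List.Properties using (map-tabulate)
open import Data.List.Relation.Unary.All as All using (All; []; _∷_)
open import Data.List.Relation.Unary.All.Properties using (∷ʳ⁺; All¬⇒¬Any; ¬Any⇒All¬)
open import Data.List.Relation.Unary.Any as Any using (Any; here; there)
open import Data.List.Relation.Unary.Any.Properties using (lookup-index)
open import Data.List.Relation.Unary.Unique.Propositional using (Unique; []; _∷_)
open import Data.Nat using (ℕ; zero; suc; _+_; _∸_; _≤_; _<_; z≤n; s≤s; s≤s⁻¹; _≤?_; _<?_)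
open import Data.Nat.GeneralisedArithmetic using (iterate)
import Data.Nat.ListAction as List
open import Data.Nat.Properties
  using ( +-0-commutativeMonoid; +-commutativeSemigroup; +-assoc; +-identityʳ; suc-injective
        ; ≤-reflexive; ≤-trans; ≤-antisym; <-irrefl; <-asym; <-cmp; n≤0⇒n≡0; 0≢1+n
        ; m≤m+n; m≤n+m; +-mono-≤; +-monoʳ-≤; +-cancelʳ-≤; m+[n∸m]≡n; ∸-monoˡ-≤
        ; module ≤-Reasoning )
open import Data.Product using (Σ; ∃; ∃-syntax; ∃₂; _×_; _,_; proj₁; proj₂)
open import Data.Sum using (_⊎_; inj₁; inj₂; [_,_]′)
open import Data.Sum.Properties using (≡-dec; inj₁-injective; inj₂-injective)
open import Data.Vec as Vec using (Vec; []; _∷_)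
open import Data.Vec.Relation.Unary.All using ([]; _∷_)
open import Data.Vec.Relation.Unary.AllPairs using ([]; _∷_)
import Data.Vec.Relation.Unary.Unique.Propositional as Vec
import Data.Vec.Relation.Unary.Unique.Propositional.Properties as Vec
open import Function using (_∘_; id)
open import Function.Bundles using (Injection)
open import Function.Definitions using (Injective)
open import Function.Properties.Inverse using (Inverse⇒Injection)
open import Relation.Binary using (Decidable; DecidableEquality; tri<; tri≈; tri>)
open import Relation.Binary.PropositionalEquality
open import Relation.Nullary using (¬_; Dec; yes; no; does; _×-dec_; _⊎-dec_)
open import Relation.Nullary.Decidable using (map′; dec-true; dec-false; from-yes)

open Algebra.Properties.CommutativeMonoid.Sum +-0-commutativeMonoid
  using (sum-syntax; ∑-distrib-+; ∑-comm; sum-cong-≗; sum-replicate-zero; sum-remove)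

least : ∀ {P : ℕ → Set} → (∀ k → Dec (P k)) → ∀ {n} → P n →
        Σ ℕ λ m → P m × (∀ {k} → P k → m ≤ k)
least P? {zero} p₀ = 0 , p₀ , λ _ → z≤n
least P? {suc n} pₙ with P? 0
... | yes p₀ = 0 , p₀ , λ _ → z≤n
... | no ¬p₀ with least (P? ∘ suc) pₙ
...   | m , pₘ , minimal = suc m , pₘ , λ { {zero} p₀ → ⊥-elim (¬p₀ p₀) ; {suc k} pₖ → s≤s (minimal pₖ) }

∃-∉ : ∀ {A : Set} {m} → DecidableEquality A → (ι : Fin m → A) → Injective _≡_ _≡_ ι →
      (xs : List A) → length xs < m → ∃[ x ] x ∉ xs
∃-∉ {m = m} _≟A_ ι ι-injective xs |xs|<m =
  Data.Product.map ι id (¬∀⟶∃¬ m _ (λ i → Any.any? (ι i ≟A_) xs) all∈)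
  where
  all∈ : ¬ (∀ i → ι i ∈ xs)
  all∈ ι∈ with i , j , i<j , same ← pigeonhole |xs|<m (Any.index ∘ ι∈) =
    <⇒≢ i<j (ι-injective (trans (lookup-index (ι∈ i))
                               (trans (cong (lookup xs) same) (sym (lookup-index (ι∈ j))))))

All-rotate : ∀ {a p} {A : Set a} {P : A → Set p} {x xs} → All P (x ∷ xs) → All P (xs ∷ʳ x)
All-rotate (px ∷ pxs) = ∷ʳ⁺ pxs px

next6²≢id : ∀ k → next6 (next6 k) ≢ k
next6²≢id 0F ()
next6²≢id 1F ()
next6²≢id 2F ()
next6²≢id 3F ()
next6²≢id 4F ()
next6²≢id 5F ()

¬T⇒≡false : ∀ {b} → ¬ T b → b ≡ false
¬T⇒≡false {false} _ = refl
¬T⇒≡false {true} ¬t = ⊥-elim (¬t _)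

≢false⇒T : ∀ {b} → b ≢ false → T b
≢false⇒T {true} _ = _
≢false⇒T {false} b≢false = ⊥-elim (b≢false refl)

𝟙 : ∀ {p} {P : Set p} → Dec P → ℕ
𝟙 P? = if does P? then 1 else 0

𝟙-yes : ∀ {p} {P : Set p} (P? : Dec P) → P → 𝟙 P? ≡ 1
𝟙-yes P? p rewrite dec-true P? p = refl

𝟙-no : ∀ {p} {P : Set p} (P? : Dec P) → ¬ P → 𝟙 P? ≡ 0
𝟙-no P? ¬p rewrite dec-false P? ¬p = refl

sum-tabulate : ∀ {n} (f : Fin n → ℕ) → List.sum (tabulate f) ≡ ∑[ i < n ] f i
sum-tabulate {zero} f = refl
sum-tabulate {suc n} f = cong (f zero +_) (sum-tabulate (f ∘ suc))

sum-allFin : ∀ {n} (f : Fin n → ℕ) → List.sum (map f (allFin n)) ≡ ∑[ i < n ] f i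
sum-allFin f = trans (cong List.sum (map-tabulate id f)) (sum-tabulate f)

∑-mono-≤ : ∀ {n} {f g : Fin n → ℕ} → (∀ i → f i ≤ g i) → ∑[ i < n ] f i ≤ ∑[ i < n ] g i
∑-mono-≤ {zero} f≤g = z≤n
∑-mono-≤ {suc n} f≤g = +-mono-≤ (f≤g zero) (∑-mono-≤ (f≤g ∘ suc))

∑-const-1 : ∀ n → ∑[ i < n ] 1 ≡ n
∑-const-1 zero = refl
∑-const-1 (suc n) = cong suc (∑-const-1 n)

∑-𝟙-≟ : ∀ {n} (i : Fin n) → ∑[ j < n ] 𝟙 (i ≟ j) ≡ 1
∑-𝟙-≟ {suc n} zero = cong suc (sum-replicate-zero n)
∑-𝟙-≟ {suc n} (suc i) = ∑-𝟙-≟ i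

≤-∑ : ∀ {n} (f : Fin n → ℕ) i → f i ≤ ∑[ j < n ] f j
≤-∑ {suc n} f i = subst (f i ≤_) (sym (sum-remove f)) (m≤m+n (f i) _)

module Graph {n₁ n₂ : ℕ} (H : SpanningSub n₁ n₂) where

  V : Set
  V = Vertex n₁ n₂

  _≟V_ : DecidableEquality V
  _≟V_ = ≡-dec _≟_ _≟_

  -- A record, so that the endpoints can be read off an adjacency proof.
  record _∼_ (u v : V) : Set where
    constructor edge
    field adjacent : Adj H u v
  open _∼_ public

  ∼-sym : ∀ {u v} → u ∼ v → v ∼ u
  ∼-sym {inj₁ _} {inj₂ _} (edge e) = edge e
  ∼-sym {inj₂ _} {inj₁ _} (edge e) = edge e

  _∼?_ : Decidable _∼_
  inj₁ a ∼? inj₂ b = map′ edge adjacent (T? (H a b))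
  inj₂ b ∼? inj₁ a = map′ edge adjacent (T? (H a b))
  inj₁ _ ∼? inj₁ _ = no λ ()
  inj₂ _ ∼? inj₂ _ = no λ ()

  Joins : Fin n₁ → Fin n₂ → V → V → Set
  Joins a b u v = u ≡ inj₁ a × v ≡ inj₂ b ⊎ u ≡ inj₂ b × v ≡ inj₁ a

  ∼-addEdge : ∀ {a b u v} → Adj (addEdge H a b) u v → u ∼ v ⊎ Joins a b u v
  ∼-addEdge {a} {b} {inj₁ a′} {inj₂ b′} e with a ≟ a′ | b ≟ b′
  ... | yes refl | yes refl = inj₂ (inj₁ (refl , refl))
  ... | yes refl | no _ = inj₁ (edge e)
  ... | no _ | _ = inj₁ (edge e)
  ∼-addEdge {a} {b} {inj₂ b′} {inj₁ a′} e with a ≟ a′ | b ≟ b′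
  ... | yes refl | yes refl = inj₂ (inj₂ (refl , refl))
  ... | yes refl | no _ = inj₁ (edge e)
  ... | no _ | _ = inj₁ (edge e)

  side : V → Bool
  side (inj₁ _) = true
  side (inj₂ _) = false

  ∼-side : ∀ {u v} → u ∼ v → side v ≡ not (side u)
  ∼-side {inj₁ _} {inj₂ _} _ = refl
  ∼-side {inj₂ _} {inj₁ _} _ = refl

  ∼∼-side : ∀ {u v w} → u ∼ v → v ∼ w → side w ≡ side u
  ∼∼-side {u} e f = trans (∼-side f) (trans (cong not (∼-side e)) (not-involutive (side u)))

  side≢⇒≢ : ∀ {u v} → side u ≢ side v → u ≢ v
  side≢⇒≢ s refl = s refl

  ∼⇒side≢ : ∀ {u v} → u ∼ v → side u ≢ side v
  ∼⇒side≢ e u≡v = not-¬ refl (trans u≡v (∼-side e))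

  ∼⇒≢ : ∀ {u v} → u ∼ v → u ≢ v
  ∼⇒≢ = side≢⇒≢ ∘ ∼⇒side≢

  ∼∼∼⇒side≢ : ∀ {u v w x} → u ∼ v → v ∼ w → w ∼ x → side u ≢ side x
  ∼∼∼⇒side≢ e f g u≡x = ∼⇒side≢ e (trans u≡x (∼∼-side f g))

  ∼∼∼⇒≢ : ∀ {u v w x} → u ∼ v → v ∼ w → w ∼ x → u ≢ x
  ∼∼∼⇒≢ e f g = side≢⇒≢ (∼∼∼⇒side≢ e f g)

  ∃V? : {P : V → Set} → (∀ v → Dec (P v)) → Dec (∃ P)
  ∃V? P? = map′ [ (λ (a , p) → inj₁ a , p) , (λ (b , p) → inj₂ b , p) ]′
                (λ { (inj₁ a , p) → inj₁ (a , p) ; (inj₂ b , p) → inj₂ (b , p) })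
                (any? (P? ∘ inj₁) ⊎-dec any? (P? ∘ inj₂))

  ∃-∉V : ∀ xs → length xs < n₁ + n₂ → ∃[ v ] v ∉ xs
  ∃-∉V = ∃-∉ _≟V_ (splitAt n₁) (Injection.injective (Inverse⇒Injection +↔⊎))

  ∑V : (V → ℕ) → ℕ
  ∑V f = ∑[ a < n₁ ] f (inj₁ a) + ∑[ b < n₂ ] f (inj₂ b)

  ∑V-mono-≤ : ∀ {f g} → (∀ v → f v ≤ g v) → ∑V f ≤ ∑V g
  ∑V-mono-≤ f≤g = +-mono-≤ (∑-mono-≤ (f≤g ∘ inj₁)) (∑-mono-≤ (f≤g ∘ inj₂))

  ∑V-cong : ∀ {f g} → (∀ v → f v ≡ g v) → ∑V f ≡ ∑V g
  ∑V-cong f≗g = cong₂ _+_ (sum-cong-≗ (f≗g ∘ inj₁)) (sum-cong-≗ (f≗g ∘ inj₂))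

  ∑V-distrib-+ : ∀ f g → ∑V (λ v → f v + g v) ≡ ∑V f + ∑V g
  ∑V-distrib-+ f g =
    trans (cong₂ _+_ (∑-distrib-+ (f ∘ inj₁) (g ∘ inj₁)) (∑-distrib-+ (f ∘ inj₂) (g ∘ inj₂)))
          (interchange +-commutativeSemigroup (∑[ a < n₁ ] f (inj₁ a)) (∑[ a < n₁ ] g (inj₁ a))
                                              (∑[ b < n₂ ] f (inj₂ b)) (∑[ b < n₂ ] g (inj₂ b)))

  ∑V-const-1 : ∑V (λ _ → 1) ≡ n₁ + n₂
  ∑V-const-1 = cong₂ _+_ (∑-const-1 n₁) (∑-const-1 n₂)

  ∑V-pred : ∀ {f} → (∀ v → 1 ≤ f v) → ∑V f ≡ n₁ + n₂ + ∑V (λ v → f v ∸ 1)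
  ∑V-pred {f} positive = begin
    ∑V f                                  ≡⟨ ∑V-cong (λ v → sym (m+[n∸m]≡n (positive v))) ⟩
    ∑V (λ v → 1 + (f v ∸ 1))              ≡⟨ ∑V-distrib-+ (λ _ → 1) (λ v → f v ∸ 1) ⟩
    ∑V (λ _ → 1) + ∑V (λ v → f v ∸ 1)     ≡⟨ cong (_+ ∑V (λ v → f v ∸ 1)) ∑V-const-1 ⟩
    n₁ + n₂ + ∑V (λ v → f v ∸ 1)          ∎
    where open ≡-Reasoning

  ∑V-𝟙-≟ : ∀ u → ∑V (λ v → 𝟙 (u ≟V v)) ≡ 1
  ∑V-𝟙-≟ (inj₁ a) = cong₂ _+_ (∑-𝟙-≟ a) (sum-replicate-zero n₂)
  ∑V-𝟙-≟ (inj₂ b) = cong₂ _+_ (sum-replicate-zero n₁) (∑-𝟙-≟ b)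

  ≤-∑V : ∀ f v → f v ≤ ∑V f
  ≤-∑V f (inj₁ a) = ≤-trans (≤-∑ (f ∘ inj₁) a) (m≤m+n _ _)
  ≤-∑V f (inj₂ b) = ≤-trans (≤-∑ (f ∘ inj₂) b) (m≤n+m _ _)

  multiplicity : List V → V → ℕ
  multiplicity [] v = 0
  multiplicity (u ∷ us) v = 𝟙 (u ≟V v) + multiplicity us v

  ∑V-multiplicity : ∀ us → ∑V (multiplicity us) ≡ length us
  ∑V-multiplicity [] = cong₂ _+_ (sum-replicate-zero n₁) (sum-replicate-zero n₂)
  ∑V-multiplicity (u ∷ us) = trans (∑V-distrib-+ (λ v → 𝟙 (u ≟V v)) (multiplicity us))
                                   (cong₂ _+_ (∑V-𝟙-≟ u) (∑V-multiplicity us))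

  multiplicity-∉ : ∀ {v us} → v ∉ us → multiplicity us v ≡ 0
  multiplicity-∉ {us = []} _ = refl
  multiplicity-∉ {v} {u ∷ us} v∉ =
    cong₂ _+_ (𝟙-no (u ≟V v) (v∉ ∘ here ∘ sym)) (multiplicity-∉ (v∉ ∘ there))

  multiplicity-≤ : ∀ {f : V → ℕ} {us} → Unique us → All (λ u → 1 ≤ f u) us →
                   ∀ v → multiplicity us v ≤ f v
  multiplicity-≤ [] [] v = z≤n
  multiplicity-≤ {f} {u ∷ us} (u∉us ∷ unique) (1≤fu ∷ positive) v with u ≟V v
  ... | yes refl = subst (_≤ f u) (sym (cong suc (multiplicity-∉ (All¬⇒¬Any u∉us)))) 1≤fu
  ... | no _ = multiplicity-≤ unique positive v

  ∑V-≥-length : ∀ {f : V → ℕ} {us} → Unique us → All (λ u → 1 ≤ f u) us → length us ≤ ∑V f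
  ∑V-≥-length {f} {us} unique positive =
    subst (_≤ ∑V f) (∑V-multiplicity us) (∑V-mono-≤ (multiplicity-≤ unique positive))

  Within : V → ℕ → V → Set
  Within r zero v = r ≡ v
  Within r (suc k) v = Within r k v ⊎ ∃[ u ] (Within r k u × u ∼ v)

  within? : ∀ r k v → Dec (Within r k v)
  within? r zero v = r ≟V v
  within? r (suc k) v = within? r k v ⊎-dec ∃V? (λ u → within? r k u ×-dec u ∼? v)

  Within-∼ : ∀ {r k u v} → Within r k u → u ∼ v → Within r (suc k) v
  Within-∼ w e = inj₂ (_ , w , e)

  Within-+ : ∀ {r k v} j → Within r k v → Within r (j + k) v
  Within-+ zero w = w
  Within-+ (suc j) w = inj₁ (Within-+ j w)

  -- Only vertices on a common side are required to be distinct: the bipartition separates the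
  -- others.  The same convention is used for squares, octagons and hexagons below.
  record Path₅ (u v : V) : Set where
    constructor path₅
    field
      {x₁ x₂ x₃ x₄} : V
      e₀ : u ∼ x₁
      e₁ : x₁ ∼ x₂
      e₂ : x₂ ∼ x₃
      e₃ : x₃ ∼ x₄
      e₄ : x₄ ∼ v
      u≢x₂ : u ≢ x₂
      u≢x₄ : u ≢ x₄
      x₂≢x₄ : x₂ ≢ x₄
      x₁≢x₃ : x₁ ≢ x₃
      x₁≢v : x₁ ≢ v
      x₃≢v : x₃ ≢ v

  reverse : ∀ {u v} → Path₅ u v → Path₅ v u
  reverse (path₅ e₀ e₁ e₂ e₃ e₄ u≢x₂ u≢x₄ x₂≢x₄ x₁≢x₃ x₁≢v x₃≢v) =
    path₅ (∼-sym e₄) (∼-sym e₃) (∼-sym e₂) (∼-sym e₁) (∼-sym e₀)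
          (≢-sym x₃≢v) (≢-sym x₁≢v) (≢-sym x₁≢x₃) (≢-sym x₂≢x₄) (≢-sym u≢x₄) (≢-sym u≢x₂)

  path₅⇒Within : ∀ {r v} → Path₅ r v → Within r 5 v
  path₅⇒Within (path₅ e₀ e₁ e₂ e₃ e₄ _ _ _ _ _ _) =
    Within-∼ (Within-∼ (Within-∼ (Within-∼ (Within-∼ refl e₀) e₁) e₂) e₃) e₄

  module _ (f : Fin 6 → V) (f-injective : Injective _≡_ _≡_ f) where
    private
      apart : ∀ {i j} → i ≢ j → f i ≢ f j
      apart i≢j = i≢j ∘ f-injective

    cycle⇒path₅ : ∀ k → (∀ m → m ≢ k → f m ∼ f (next6 m)) → Path₅ (f (next6 k)) (f k)
    cycle⇒path₅ 0F e = path₅ (e 1F λ ()) (e 2F λ ()) (e 3F λ ()) (e 4F λ ()) (e 5F λ ())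
                           (apart λ ()) (apart λ ()) (apart λ ()) (apart λ ()) (apart λ ()) (apart λ ())
    cycle⇒path₅ 1F e = path₅ (e 2F λ ()) (e 3F λ ()) (e 4F λ ()) (e 5F λ ()) (e 0F λ ())
                           (apart λ ()) (apart λ ()) (apart λ ()) (apart λ ()) (apart λ ()) (apart λ ())
    cycle⇒path₅ 2F e = path₅ (e 3F λ ()) (e 4F λ ()) (e 5F λ ()) (e 0F λ ()) (e 1F λ ())
                           (apart λ ()) (apart λ ()) (apart λ ()) (apart λ ()) (apart λ ()) (apart λ ())
    cycle⇒path₅ 3F e = path₅ (e 4F λ ()) (e 5F λ ()) (e 0F λ ()) (e 1F λ ()) (e 2F λ ())
                           (apart λ ()) (apart λ ()) (apart λ ()) (apart λ ()) (apart λ ()) (apart λ ())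
    cycle⇒path₅ 4F e = path₅ (e 5F λ ()) (e 0F λ ()) (e 1F λ ()) (e 2F λ ()) (e 3F λ ())
                           (apart λ ()) (apart λ ()) (apart λ ()) (apart λ ()) (apart λ ()) (apart λ ())
    cycle⇒path₅ 5F e = path₅ (e 0F λ ()) (e 1F λ ()) (e 2F λ ()) (e 3F λ ()) (e 4F λ ())
                           (apart λ ()) (apart λ ()) (apart λ ()) (apart λ ()) (apart λ ()) (apart λ ())

  Exit : List V → Set
  Exit xs = ∃[ w ] (Any (_∼ w) xs × All (w ≢_) xs)

  leave : ∀ {xs u v} → Path₅ u v → u ∈ xs → v ∉ xs → Exit xs
  leave {xs} (path₅ e₀ e₁ e₂ e₃ e₄ _ _ _ _ _ _) u∈ v∉ =
    step u∈ e₀ λ x₁∈ → step x₁∈ e₁ λ x₂∈ → step x₂∈ e₂ λ x₃∈ → step x₃∈ e₃ λ x₄∈ →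
    step x₄∈ e₄ (⊥-elim ∘ v∉)
    where
    step : ∀ {x y} → x ∈ xs → x ∼ y → (y ∈ xs → Exit xs) → Exit xs
    step {y = y} x∈ e continue with Any.any? (y ≟V_) xs
    ... | yes y∈ = continue y∈
    ... | no y∉ = y , Any.map (λ { refl → e }) x∈ , ¬Any⇒All¬ xs y∉

  hexagon : ∀ {x₀ x₁ x₂ x₃ x₄ x₅} →
            x₀ ∼ x₁ → x₁ ∼ x₂ → x₂ ∼ x₃ → x₃ ∼ x₄ → x₄ ∼ x₅ → x₅ ∼ x₀ →
            x₀ ≢ x₂ → x₀ ≢ x₄ → x₂ ≢ x₄ → x₁ ≢ x₃ → x₁ ≢ x₅ → x₃ ≢ x₅ → ContainsC6 H
  hexagon {x₀} {x₁} {x₂} {x₃} {x₄} {x₅} e₀ e₁ e₂ e₃ e₄ e₅ x₀≢x₂ x₀≢x₄ x₂≢x₄ x₁≢x₃ x₁≢x₅ x₃≢x₅ =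
    Vec.lookup xs , Vec.lookup-injective distinct _ _ , adjacency
    where
    xs : Vec V 6
    xs = x₀ ∷ x₁ ∷ x₂ ∷ x₃ ∷ x₄ ∷ x₅ ∷ []
    distinct : Vec.Unique xs
    distinct = (∼⇒≢ e₀ ∷ x₀≢x₂ ∷ ∼∼∼⇒≢ e₀ e₁ e₂ ∷ x₀≢x₄ ∷ ∼⇒≢ (∼-sym e₅) ∷ [])
             ∷ (∼⇒≢ e₁ ∷ x₁≢x₃ ∷ ∼∼∼⇒≢ e₁ e₂ e₃ ∷ x₁≢x₅ ∷ [])
             ∷ (∼⇒≢ e₂ ∷ x₂≢x₄ ∷ ∼∼∼⇒≢ e₂ e₃ e₄ ∷ [])
             ∷ (∼⇒≢ e₃ ∷ x₃≢x₅ ∷ [])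
             ∷ (∼⇒≢ e₄ ∷ [])
             ∷ [] ∷ []
    adjacency : ∀ i → Adj H (Vec.lookup xs i) (Vec.lookup xs (next6 i))
    adjacency 0F = adjacent e₀
    adjacency 1F = adjacent e₁
    adjacency 2F = adjacent e₂
    adjacency 3F = adjacent e₃
    adjacency 4F = adjacent e₄
    adjacency 5F = adjacent e₅

  record Square : Set where
    constructor square
    field
      {x₀ x₁ x₂ x₃} : V
      e₀ : x₀ ∼ x₁
      e₁ : x₁ ∼ x₂
      e₂ : x₂ ∼ x₃
      e₃ : x₃ ∼ x₀
      x₀≢x₂ : x₀ ≢ x₂
      x₁≢x₃ : x₁ ≢ x₃

    corners : List V
    corners = x₀ ∷ x₁ ∷ x₂ ∷ x₃ ∷ []

  rotate□ : Square → Square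
  rotate□ (square e₀ e₁ e₂ e₃ x₀≢x₂ x₁≢x₃) = square e₁ e₂ e₃ e₀ x₁≢x₃ (≢-sym x₀≢x₂)

  All-rotate□ⁿ : ∀ {P : V → Set} k C →
                 All P (Square.corners C) → All P (Square.corners (iterate rotate□ C k))
  All-rotate□ⁿ zero C ps = ps
  All-rotate□ⁿ (suc k) C ps = All-rotate□ⁿ k (rotate□ C) (All-rotate ps)

  AnchoredSquare : V → Set
  AnchoredSquare w = Σ Square λ C → Square.x₀ C ∼ w × All (w ≢_) (Square.corners C)

  anchor□ : ∀ {w} C → Any (_∼ w) (Square.corners C) → All (w ≢_) (Square.corners C) →
            AnchoredSquare w
  anchor□ C (here e) out = C , e , out
  anchor□ C (there (here e)) out = iterate rotate□ C 1 , e , All-rotate□ⁿ 1 C out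
  anchor□ C (there (there (here e))) out = iterate rotate□ C 2 , e , All-rotate□ⁿ 2 C out
  anchor□ C (there (there (there (here e)))) out = iterate rotate□ C 3 , e , All-rotate□ⁿ 3 C out

  record Octagon : Set where
    constructor octagon
    field
      {x₀ x₁ x₂ x₃ x₄ x₅ x₆ x₇} : V
      e₀ : x₀ ∼ x₁
      e₁ : x₁ ∼ x₂
      e₂ : x₂ ∼ x₃
      e₃ : x₃ ∼ x₄
      e₄ : x₄ ∼ x₅
      e₅ : x₅ ∼ x₆
      e₆ : x₆ ∼ x₇
      e₇ : x₇ ∼ x₀
      x₀≢x₂ : x₀ ≢ x₂
      x₀≢x₄ : x₀ ≢ x₄
      x₀≢x₆ : x₀ ≢ x₆
      x₂≢x₄ : x₂ ≢ x₄
      x₂≢x₆ : x₂ ≢ x₆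
      x₄≢x₆ : x₄ ≢ x₆
      x₁≢x₃ : x₁ ≢ x₃
      x₁≢x₅ : x₁ ≢ x₅
      x₁≢x₇ : x₁ ≢ x₇
      x₃≢x₅ : x₃ ≢ x₅
      x₃≢x₇ : x₃ ≢ x₇
      x₅≢x₇ : x₅ ≢ x₇

    corners : List V
    corners = x₀ ∷ x₁ ∷ x₂ ∷ x₃ ∷ x₄ ∷ x₅ ∷ x₆ ∷ x₇ ∷ []

  rotate⁸ : Octagon → Octagon
  rotate⁸ (octagon e₀ e₁ e₂ e₃ e₄ e₅ e₆ e₇ x₀≢x₂ x₀≢x₄ x₀≢x₆ x₂≢x₄ x₂≢x₆ x₄≢x₆
                   x₁≢x₃ x₁≢x₅ x₁≢x₇ x₃≢x₅ x₃≢x₇ x₅≢x₇) =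
    octagon e₁ e₂ e₃ e₄ e₅ e₆ e₇ e₀ x₁≢x₃ x₁≢x₅ x₁≢x₇ x₃≢x₅ x₃≢x₇ x₅≢x₇
            x₂≢x₄ x₂≢x₆ (≢-sym x₀≢x₂) x₄≢x₆ (≢-sym x₀≢x₄) (≢-sym x₀≢x₆)

  All-rotate⁸ⁿ : ∀ {P : V → Set} k C →
                 All P (Octagon.corners C) → All P (Octagon.corners (iterate rotate⁸ C k))
  All-rotate⁸ⁿ zero C ps = ps
  All-rotate⁸ⁿ (suc k) C ps = All-rotate⁸ⁿ k (rotate⁸ C) (All-rotate ps)

  AnchoredOctagon : V → Set
  AnchoredOctagon w = Σ Octagon λ C → Octagon.x₀ C ∼ w × All (w ≢_) (Octagon.corners C)

  anchor⁸ : ∀ {w} C → Any (_∼ w) (Octagon.corners C) → All (w ≢_) (Octagon.corners C) →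
            AnchoredOctagon w
  anchor⁸ C (here e) out = C , e , out
  anchor⁸ C (there (here e)) out = iterate rotate⁸ C 1 , e , All-rotate⁸ⁿ 1 C out
  anchor⁸ C (there (there (here e))) out = iterate rotate⁸ C 2 , e , All-rotate⁸ⁿ 2 C out
  anchor⁸ C (there (there (there (here e)))) out = iterate rotate⁸ C 3 , e , All-rotate⁸ⁿ 3 C out
  anchor⁸ C (there (there (there (there (here e))))) out =
    iterate rotate⁸ C 4 , e , All-rotate⁸ⁿ 4 C out
  anchor⁸ C (there (there (there (there (there (here e)))))) out =
    iterate rotate⁸ C 5 , e , All-rotate⁸ⁿ 5 C out
  anchor⁸ C (there (there (there (there (there (there (here e))))))) out =
    iterate rotate⁸ C 6 , e , All-rotate⁸ⁿ 6 C out
  anchor⁸ C (there (there (there (there (there (there (there (here e)))))))) out =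
    iterate rotate⁸ C 7 , e , All-rotate⁸ⁿ 7 C out

  module BFS (r : V) {D : ℕ} (reach : ∀ v → Within r D v) where

    private
      nearest : ∀ v → Σ ℕ λ k → Within r k v × (∀ {j} → Within r j v → k ≤ j)
      nearest v = least (λ k → within? r k v) (reach v)

    dist : V → ℕ
    dist v = proj₁ (nearest v)

    within-dist : ∀ v → Within r (dist v) v
    within-dist v = proj₁ (proj₂ (nearest v))

    dist-minimal : ∀ {k v} → Within r k v → dist v ≤ k
    dist-minimal {v = v} = proj₂ (proj₂ (nearest v))

    dist-root : dist r ≡ 0
    dist-root = n≤0⇒n≡0 (dist-minimal refl)

    dist≡0⇒root : ∀ {v} → dist v ≡ 0 → r ≡ v
    dist≡0⇒root {v} d≡0 = subst (λ k → Within r k v) d≡0 (within-dist v)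

    dist-∼-≤ : ∀ {u v} → u ∼ v → dist v ≤ suc (dist u)
    dist-∼-≤ {u} e = dist-minimal (Within-∼ (within-dist u) e)

    parent : ∀ {v k} → dist v ≡ suc k → ∃[ u ] (u ∼ v × dist u ≡ k)
    parent {v} {k} d≡1+k with subst (λ j → Within r j v) d≡1+k (within-dist v)
    ... | inj₁ within-k = ⊥-elim (<-irrefl refl (subst (_≤ k) d≡1+k (dist-minimal within-k)))
    ... | inj₂ (u , within-k , e) =
      u , e , ≤-antisym (dist-minimal within-k) (s≤s⁻¹ (subst (_≤ suc (dist u)) d≡1+k (dist-∼-≤ e)))

    equidistant⇒same-side : ∀ k {u v} → dist u ≡ k → dist v ≡ k → side u ≡ side v
    equidistant⇒same-side zero du dv = cong side (trans (sym (dist≡0⇒root du)) (dist≡0⇒root dv))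
    equidistant⇒same-side (suc k) du dv with parent du | parent dv
    ... | u′ , e , du′ | v′ , f , dv′ =
      trans (∼-side e) (trans (cong not (equidistant⇒same-side k du′ dv′)) (sym (∼-side f)))

    ∼⇒dist≢ : ∀ {u v} → u ∼ v → dist u ≢ dist v
    ∼⇒dist≢ e du≡dv = ∼⇒side≢ e (equidistant⇒same-side _ du≡dv refl)

    dist-∼ : ∀ {u v} → u ∼ v → dist v ≡ suc (dist u) ⊎ dist u ≡ suc (dist v)
    dist-∼ {u} {v} e with <-cmp (dist u) (dist v)
    ... | tri< du<dv _ _ = inj₁ (≤-antisym (dist-∼-≤ e) du<dv)
    ... | tri≈ _ du≡dv _ = ⊥-elim (∼⇒dist≢ e du≡dv)
    ... | tri> _ _ dv<du = inj₂ (≤-antisym (dist-∼-≤ (∼-sym e)) dv<du)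

    ∼root⇒dist≡1 : ∀ {v} → r ∼ v → dist v ≡ 1
    ∼root⇒dist≡1 e with dist-∼ e
    ... | inj₁ dv≡1+dr = trans dv≡1+dr (cong suc dist-root)
    ... | inj₂ dr≡1+dv = ⊥-elim (0≢1+n (trans (sym dist-root) dr≡1+dv))

    dist≡1⇒∼root : ∀ {v} → dist v ≡ 1 → r ∼ v
    dist≡1⇒∼root dv≡1 with parent dv≡1
    ... | u , e , du≡0 with dist≡0⇒root du≡0
    ...   | refl = e

    dist-∼-up : ∀ {u v k} → u ∼ v → dist u ≡ suc k → dist v ≢ k → dist v ≡ suc (suc k)
    dist-∼-up e du dv≢k with dist-∼ e
    ... | inj₁ dv = trans dv (cong suc du)
    ... | inj₂ du′ = ⊥-elim (dv≢k (suc-injective (trans (sym du′) du)))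

    ≢-by-dist : ∀ {u v i j} → dist u ≡ i → dist v ≡ j → i ≢ j → u ≢ v
    ≢-by-dist du dv i≢j refl = i≢j (trans (sym du) dv)

    _⊏_ : V → V → Set
    u ⊏ v = u ∼ v × dist u < dist v

    _⊏?_ : Decidable _⊏_
    u ⊏? v = u ∼? v ×-dec dist u <? dist v

    ascend : ∀ {u v} → u ∼ v → dist v ≡ suc (dist u) → u ⊏ v
    ascend e dv = e , ≤-reflexive (sym dv)

    descend : ∀ {u v} → u ∼ v → dist u ≡ suc (dist v) → v ⊏ u
    descend e du = ascend (∼-sym e) du

    ⊏-by-dist : ∀ {u v k} → u ∼ v → dist u ≡ k → dist v ≡ suc k → u ⊏ v
    ⊏-by-dist e du dv = ascend e (trans dv (cong suc (sym du)))

    ⊏⇒dist : ∀ {u v} → u ⊏ v → dist v ≡ suc (dist u)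
    ⊏⇒dist (e , du<dv) with dist-∼ e
    ... | inj₁ dv = dv
    ... | inj₂ du = ⊥-elim (<-asym du<dv (≤-reflexive (sym du)))

    has-parent : ∀ {v} → r ≢ v → ∃[ u ] u ⊏ v
    has-parent {v} r≢v = from-dist (dist v) refl
      where
      from-dist : ∀ k → dist v ≡ k → ∃[ u ] u ⊏ v
      from-dist zero dv = ⊥-elim (r≢v (dist≡0⇒root dv))
      from-dist (suc k) dv with parent dv
      ... | u , e , du = u , ⊏-by-dist e du dv

    record Fork (z : V) : Set where
      constructor fork
      field
        {p₁ p₂} : V
        p₁⊏z : p₁ ⊏ z
        p₂⊏z : p₂ ⊏ z
        p₁≢p₂ : p₁ ≢ p₂

    record Peak (v : V) : Set where
      constructor peak-at
      field
        {z} : V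
        z-fork : Fork z
        z≢v : z ≢ v
        low-or-last : dist z ≤ 3 ⊎ z ∼ v

    -- Along a path from the root the distance rises by one per step until it first drops;
    -- the vertex where it turns is a fork.
    peak : ∀ {v} → Path₅ r v → dist v ≤ 3 → Peak v
    peak (path₅ e₀ e₁ e₂ e₃ e₄ r≢x₂ _ x₂≢x₄ x₁≢x₃ x₁≢v x₃≢v) dv≤3
      with dist-∼ e₁ | dist-∼ e₂ | dist-∼ e₃ | dist-∼ e₄
    ... | inj₂ ↓₁ | _ | _ | _ =
      peak-at (fork (⊏-by-dist e₀ dist-root (∼root⇒dist≡1 e₀)) (descend e₁ ↓₁) r≢x₂) x₁≢v
              (inj₁ (dist-minimal (Within-+ 2 (Within-∼ refl e₀))))
    ... | inj₁ ↑₁ | inj₂ ↓₂ | _ | _ =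
      peak-at (fork (ascend e₁ ↑₁) (descend e₂ ↓₂) x₁≢x₃) (∼∼∼⇒≢ e₂ e₃ e₄)
              (inj₁ (dist-minimal (Within-+ 1 (Within-∼ (Within-∼ refl e₀) e₁))))
    ... | inj₁ _ | inj₁ ↑₂ | inj₂ ↓₃ | _ =
      peak-at (fork (ascend e₂ ↑₂) (descend e₃ ↓₃) x₂≢x₄) x₃≢v
              (inj₁ (dist-minimal (Within-∼ (Within-∼ (Within-∼ refl e₀) e₁) e₂)))
    ... | inj₁ _ | inj₁ _ | inj₁ ↑₃ | inj₂ ↓₄ =
      peak-at (fork (ascend e₃ ↑₃) (descend e₄ ↓₄) x₃≢v) (∼⇒≢ e₄) (inj₂ e₄)
    ... | inj₁ ↑₁ | inj₁ ↑₂ | inj₁ ↑₃ | inj₁ ↑₄ = ⊥-elim (5≰3 (subst (_≤ 3) dv≡5 dv≤3))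
      where
      5≰3 : ¬ 5 ≤ 3
      5≰3 (s≤s (s≤s (s≤s ())))
      dv≡5 = trans ↑₄ (cong suc (trans ↑₃ (cong suc (trans ↑₂ (cong suc
               (trans ↑₁ (cong suc (∼root⇒dist≡1 e₀))))))))

    data Surplus : Set where
      two-forks : ∀ {z₁ z₂} → Fork z₁ → Fork z₂ → z₁ ≢ z₂ → Surplus
      triple-fork : ∀ {z p₁ p₂ p₃} → p₁ ⊏ z → p₂ ⊏ z → p₃ ⊏ z →
                    p₁ ≢ p₂ → p₁ ≢ p₃ → p₂ ≢ p₃ → Surplus

    downDegree : V → ℕ
    downDegree v = ∑V λ u → 𝟙 (u ⊏? v)

    downDegree-≥ : ∀ {v ps} → Unique ps → All (_⊏ v) ps → length ps ≤ downDegree v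
    downDegree-≥ {v} unique ps⊏v =
      ∑V-≥-length unique (All.map (λ {p} p⊏v → ≤-reflexive (sym (𝟙-yes (p ⊏? v) p⊏v))) ps⊏v)

    fork⇒downDegree : ∀ {z} → Fork z → 2 ≤ downDegree z
    fork⇒downDegree (fork p₁⊏z p₂⊏z p₁≢p₂) = downDegree-≥ ((p₁≢p₂ ∷ []) ∷ [] ∷ []) (p₁⊏z ∷ p₂⊏z ∷ [])

    -- Every edge joins two distinct levels, so it is counted once, at its upper end.
    edge-split : ∀ a b → 𝟙 (inj₂ b ⊏? inj₁ a) + 𝟙 (inj₁ a ⊏? inj₂ b) ≡ (if H a b then 1 else 0)
    edge-split a b with H a b in Hab
    ... | false = refl
    ... | true with <-cmp (dist (inj₁ a)) (dist (inj₂ b))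
    ...   | tri< a<b _ _ = cong₂ _+_ (𝟙-no (_ <? _) (<-asym a<b)) (𝟙-yes (_ <? _) a<b)
    ...   | tri≈ _ a≡b _ = ⊥-elim (∼⇒dist≢ (edge {inj₁ a} {inj₂ b} (subst T (sym Hab) _)) a≡b)
    ...   | tri> _ _ b<a = cong₂ _+_ (𝟙-yes (_ <? _) b<a) (𝟙-no (_ <? _) (<-asym b<a))

    edgeCount≡∑downDegree : edgeCount H ≡ ∑V downDegree
    edgeCount≡∑downDegree = begin
      edgeCount H
        ≡⟨ trans (sum-allFin (λ a → List.sum (map (e a) (allFin n₂))))
                 (sum-cong-≗ λ a → sum-allFin (e a)) ⟩
      ∑[ a < n₁ ] ∑[ b < n₂ ] e a b
        ≡⟨ sum-cong-≗ (λ a → sum-cong-≗ λ b → sym (edge-split a b)) ⟩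
      ∑[ a < n₁ ] ∑[ b < n₂ ] (b⊏a a b + a⊏b a b)
        ≡⟨ trans (sum-cong-≗ λ a → ∑-distrib-+ (b⊏a a) (a⊏b a))
                 (∑-distrib-+ (λ a → ∑[ b < n₂ ] b⊏a a b) (λ a → ∑[ b < n₂ ] a⊏b a b)) ⟩
      ∑[ a < n₁ ] ∑[ b < n₂ ] b⊏a a b + ∑[ a < n₁ ] ∑[ b < n₂ ] a⊏b a b
        ≡⟨ cong₂ _+_ (sum-cong-≗ λ a → cong (_+ ∑[ b < n₂ ] b⊏a a b) (sym (sum-replicate-zero n₁)))
                     (trans (∑-comm a⊏b) (sum-cong-≗ λ b → sym (+-identityʳ (∑[ a < n₁ ] a⊏b a b)))) ⟩
      ∑[ a < n₁ ] (∑[ _ < n₁ ] 0 + ∑[ b < n₂ ] b⊏a a b) + ∑[ b < n₂ ] (∑[ a < n₁ ] a⊏b a b + 0)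
        ≡⟨ cong (∑[ a < n₁ ] downDegree (inj₁ a) +_)
                (sum-cong-≗ λ b → cong (∑[ a < n₁ ] a⊏b a b +_) (sym (sum-replicate-zero n₂))) ⟩
      ∑V downDegree ∎
      where
      open ≡-Reasoning
      e b⊏a a⊏b : Fin n₁ → Fin n₂ → ℕ
      e a b = if H a b then 1 else 0
      b⊏a a b = 𝟙 (inj₂ b ⊏? inj₁ a)
      a⊏b a b = 𝟙 (inj₁ a ⊏? inj₂ b)

    surplus⇒edgeCount : Surplus → n₁ + n₂ + 1 ≤ edgeCount H
    surplus⇒edgeCount s = +-cancelʳ-≤ 1 _ _ (begin
      n₁ + n₂ + 1 + 1                         ≡⟨ +-assoc (n₁ + n₂) 1 1 ⟩
      n₁ + n₂ + 2                             ≤⟨ +-monoʳ-≤ (n₁ + n₂) (excess s) ⟩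
      n₁ + n₂ + ∑V (λ v → f v ∸ 1)            ≡⟨ sym (∑V-pred f-positive) ⟩
      ∑V f                                    ≡⟨ ∑V-distrib-+ downDegree (λ v → 𝟙 (r ≟V v)) ⟩
      ∑V downDegree + ∑V (λ v → 𝟙 (r ≟V v))   ≡⟨ cong₂ _+_ (sym edgeCount≡∑downDegree) (∑V-𝟙-≟ r) ⟩
      edgeCount H + 1                         ∎)
      where
      open ≤-Reasoning
      f : V → ℕ
      f v = downDegree v + 𝟙 (r ≟V v)

      f-positive : ∀ v → 1 ≤ f v
      f-positive v with r ≟V v
      ... | yes _ = m≤n+m 1 (downDegree v)
      ... | no r≢v with has-parent r≢v
      ...   | u , u⊏v = ≤-trans (downDegree-≥ ([] ∷ []) (u⊏v ∷ [])) (m≤m+n _ _)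

      excess : Surplus → 2 ≤ ∑V (λ v → f v ∸ 1)
      excess (two-forks {z₁} {z₂} φ₁ φ₂ z₁≢z₂) =
        ∑V-≥-length ((z₁≢z₂ ∷ []) ∷ [] ∷ []) (lower φ₁ ∷ lower φ₂ ∷ [])
        where
        lower : ∀ {z} → Fork z → 1 ≤ f z ∸ 1
        lower φ = ∸-monoˡ-≤ 1 (≤-trans (fork⇒downDegree φ) (m≤m+n _ _))
      excess (triple-fork {z} p₁⊏z p₂⊏z p₃⊏z p₁≢p₂ p₁≢p₃ p₂≢p₃) =
        ≤-trans (∸-monoˡ-≤ 1 (≤-trans three (m≤m+n _ _))) (≤-∑V (λ v → f v ∸ 1) z)
        where
        three = downDegree-≥ ((p₁≢p₂ ∷ p₁≢p₃ ∷ []) ∷ (p₂≢p₃ ∷ []) ∷ [] ∷ []) (p₁⊏z ∷ p₂⊏z ∷ p₃⊏z ∷ [])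

module Saturated {n₁ n₂ : ℕ} (H : SpanningSub n₁ n₂) (C6-free : ¬ ContainsC6 H)
                 (saturated : ∀ a b → H a b ≡ false → ContainsC6 (addEdge H a b))
                 (5≤n₁ : 5 ≤ n₁) (5≤n₂ : 5 ≤ n₂) where

  open Graph H

  joins-once : ∀ {f : Fin 6 → V} {a b m k} → Injective _≡_ _≡_ f →
               Joins a b (f m) (f (next6 m)) → Joins a b (f k) (f (next6 k)) → m ≡ k
  joins-once f-inj (inj₁ (fm , _)) (inj₁ (fk , _)) = f-inj (trans fm (sym fk))
  joins-once f-inj (inj₂ (fm , _)) (inj₂ (fk , _)) = f-inj (trans fm (sym fk))
  joins-once {k = k} f-inj (inj₁ (fm , fm′)) (inj₂ (fk , fk′)) with f-inj (trans fm (sym fk′))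
  ... | refl = ⊥-elim (next6²≢id k (f-inj (trans fm′ (sym fk))))
  joins-once {k = k} f-inj (inj₂ (fm , fm′)) (inj₁ (fk , fk′)) with f-inj (trans fm (sym fk′))
  ... | refl = ⊥-elim (next6²≢id k (f-inj (trans fm′ (sym fk))))

  orient : ∀ {a b u v} → Joins a b u v → Path₅ v u → Path₅ (inj₁ a) (inj₂ b)
  orient (inj₁ (refl , refl)) P = reverse P
  orient (inj₂ (refl , refl)) P = P

  nonedge⇒path₅ : ∀ {a b} → H a b ≡ false → Path₅ (inj₁ a) (inj₂ b)
  nonedge⇒path₅ {a} {b} Hab with saturated a b Hab
  ... | f , f-injective , f-adjacent with all? (λ k → f k ∼? f (next6 k))
  ...   | yes old = ⊥-elim (C6-free (f , f-injective , adjacent ∘ old))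
  ...   | no ¬old with ¬∀⟶∃¬ 6 _ (λ k → f k ∼? f (next6 k)) ¬old
  ...     | k , new with ∼-addEdge (f-adjacent k)
  ...       | inj₁ e = ⊥-elim (new e)
  ...       | inj₂ k-joins = orient k-joins (cycle⇒path₅ f f-injective k others)
    where
    others : ∀ m → m ≢ k → f m ∼ f (next6 m)
    others m m≢k with ∼-addEdge (f-adjacent m)
    ... | inj₁ e = e
    ... | inj₂ m-joins = ⊥-elim (m≢k (joins-once f-injective m-joins k-joins))

  nonadjacent⇒path₅ : ∀ {u v} → side u ≢ side v → ¬ u ∼ v → Path₅ u v
  nonadjacent⇒path₅ {inj₁ _} {inj₂ _} _ ¬e = nonedge⇒path₅ (¬T⇒≡false (¬e ∘ edge))
  nonadjacent⇒path₅ {inj₂ _} {inj₁ _} _ ¬e = reverse (nonedge⇒path₅ (¬T⇒≡false (¬e ∘ edge)))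
  nonadjacent⇒path₅ {inj₁ _} {inj₁ _} s _ = ⊥-elim (s refl)
  nonadjacent⇒path₅ {inj₂ _} {inj₂ _} s _ = ⊥-elim (s refl)

  pick₁ : Fin 5 → Fin n₁
  pick₁ i = inject≤ i 5≤n₁

  pick₂ : Fin 5 → Fin n₂
  pick₂ i = inject≤ i 5≤n₂

  across : V → V
  across (inj₁ _) = inj₂ (pick₂ 0F)
  across (inj₂ _) = inj₁ (pick₁ 0F)

  side-across : ∀ v → side v ≢ side (across v)
  side-across (inj₁ _) ()
  side-across (inj₂ _) ()

  neighbour : ∀ v → ∃[ u ] v ∼ u
  neighbour v with v ∼? across v
  ... | yes e = _ , e
  ... | no ¬e = _ , Path₅.e₀ (nonadjacent⇒path₅ (side-across v) ¬e)

  within₅ : ∀ {r v} → side r ≢ side v → Within r 5 v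
  within₅ {r} {v} r≁v with r ∼? v
  ... | yes e = Within-+ 4 (Within-∼ refl e)
  ... | no ¬e = path₅⇒Within (nonadjacent⇒path₅ r≁v ¬e)

  reach : ∀ r v → Within r 6 v
  reach r v with side r Data.Bool.≟ side v
  ... | no r≁v = Within-+ 1 (within₅ r≁v)
  ... | yes r≈v with neighbour v
  ...   | u , v∼u = Within-∼ (within₅ (λ r≈u → ∼⇒side≢ v∼u (trans (sym r≈v) r≈u))) (∼-sym v∼u)

  module From (r : V) = BFS r (reach r)

  Certificate : Set
  Certificate = Σ V From.Surplus

  certificate⇒edgeCount : Certificate → n₁ + n₂ + 1 ≤ edgeCount H
  certificate⇒edgeCount (r , surplus) = From.surplus⇒edgeCount r surplus

  module _ (r : V) where
    open From r

    fork⇒square : ∀ {z} → Fork z → dist z ≤ 3 → Square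
    fork⇒square {z} (fork {p₁} {p₂} p₁⊏z p₂⊏z p₁≢p₂) dz≤3 =
      at-depth (dist p₁) refl dp₂ (⊏⇒dist p₁⊏z) (s≤s⁻¹ (subst (_≤ 3) (⊏⇒dist p₁⊏z) dz≤3))
      where
      dp₂ : dist p₂ ≡ dist p₁
      dp₂ = suc-injective (trans (sym (⊏⇒dist p₂⊏z)) (⊏⇒dist p₁⊏z))
      p₁∼z = proj₁ p₁⊏z
      z∼p₂ = ∼-sym (proj₁ p₂⊏z)

      at-depth : ∀ k → dist p₁ ≡ k → dist p₂ ≡ k → dist z ≡ suc k → k ≤ 2 → Square
      at-depth 0 d₁ d₂ _ _ = ⊥-elim (p₁≢p₂ (trans (sym (dist≡0⇒root d₁)) (dist≡0⇒root d₂)))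
      at-depth 1 d₁ d₂ dz _ =
        square (dist≡1⇒∼root d₁) p₁∼z z∼p₂ (∼-sym (dist≡1⇒∼root d₂)) (≢-by-dist dist-root dz λ ()) p₁≢p₂
      at-depth 2 d₁ d₂ dz _ with parent d₁ | parent d₂
      ... | q₁ , q₁∼p₁ , dq₁ | q₂ , q₂∼p₂ , dq₂ with q₁ ≟V q₂
      ...   | yes refl = square q₁∼p₁ p₁∼z z∼p₂ (∼-sym q₂∼p₂) (≢-by-dist dq₁ dz λ ()) p₁≢p₂
      ...   | no q₁≢q₂ = ⊥-elim (C6-free (hexagon
              (dist≡1⇒∼root dq₁) q₁∼p₁ p₁∼z z∼p₂ (∼-sym q₂∼p₂) (∼-sym (dist≡1⇒∼root dq₂))
              (≢-by-dist dist-root d₁ λ ()) (≢-by-dist dist-root d₂ λ ()) p₁≢p₂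
              (≢-by-dist dq₁ dz λ ()) q₁≢q₂ (≢-by-dist dz dq₂ λ ())))
      at-depth (suc (suc (suc _))) _ _ _ (s≤s (s≤s ()))

  anchored-square⇒certificate : ∀ {w} → AnchoredSquare w → Certificate
  anchored-square⇒certificate {w}
    (square {x₀} {x₁} {x₂} {x₃} e₀ e₁ e₂ e₃ x₀≢x₂ x₁≢x₃ , x₀∼w , _ ∷ w≢x₁ ∷ _ ∷ w≢x₃ ∷ [])
    with w ∼? x₂
  ... | yes w∼x₂ =
    x₀ , triple-fork (⊏-by-dist e₁ d₁ d₂) (⊏-by-dist (∼-sym e₂) d₃ d₂) (⊏-by-dist w∼x₂ d-w d₂)
                     x₁≢x₃ (≢-sym w≢x₁) (≢-sym w≢x₃)
    where
    open From x₀
    d₁ = ∼root⇒dist≡1 e₀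
    d₃ = ∼root⇒dist≡1 (∼-sym e₃)
    d-w = ∼root⇒dist≡1 x₀∼w
    d₂ = dist-∼-up e₁ d₁ (x₀≢x₂ ∘ dist≡0⇒root)
  ... | no ¬w∼x₂ =
    w , two-forks (fork (⊏-by-dist e₁ d₁ d₂) (⊏-by-dist (∼-sym e₂) d₃ d₂) x₁≢x₃) z-fork (≢-sym z≢v)
    where
    open From w
    d₀ = ∼root⇒dist≡1 (∼-sym x₀∼w)
    d₁ = dist-∼-up e₀ d₀ (w≢x₁ ∘ dist≡0⇒root)
    d₃ = dist-∼-up (∼-sym e₃) d₀ (w≢x₃ ∘ dist≡0⇒root)
    d₂ = dist-∼-up e₁ d₁ (¬w∼x₂ ∘ dist≡1⇒∼root)
    open Peak (peak (nonadjacent⇒path₅ (∼∼∼⇒side≢ (∼-sym x₀∼w) e₀ e₁) ¬w∼x₂) (≤-reflexive d₂))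

  module AtOctagon (C : Octagon) {w} (x₀∼w : Octagon.x₀ C ∼ w) (w∉C : All (w ≢_) (Octagon.corners C))
    where
    open Octagon C
    open From w

    w≢x₁ : w ≢ x₁
    w≢x₁ = All.lookup w∉C (there (here refl))

    w≢x₇ : w ≢ x₇
    w≢x₇ = All.lookup w∉C (there (there (there (there (there (there (there (here refl))))))))

    w⇝x₁ : Within w 2 x₁
    w⇝x₁ = Within-∼ (Within-∼ refl (∼-sym x₀∼w)) e₀

    w⇝x₇ : Within w 2 x₇
    w⇝x₇ = Within-∼ (Within-∼ refl (∼-sym x₀∼w)) (∼-sym e₇)

    module _ (¬w∼x₂ : ¬ w ∼ x₂) (¬w∼x₆ : ¬ w ∼ x₆) where

      peak₂ : Peak x₂
      peak₂ = peak (nonadjacent⇒path₅ (∼∼∼⇒side≢ (∼-sym x₀∼w) e₀ e₁) ¬w∼x₂)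
                   (dist-minimal (Within-∼ w⇝x₁ e₁))

      peak₆ : Peak x₆
      peak₆ = peak (nonadjacent⇒path₅ (∼∼∼⇒side≢ (∼-sym x₀∼w) (∼-sym e₇) (∼-sym e₆)) ¬w∼x₆)
                   (dist-minimal (Within-∼ w⇝x₇ (∼-sym e₆)))

      -- Off the octagon, z would close the hexagon z x₂ x₁ x₀ x₇ x₆.
      common-neighbour : ∀ {z} → z ∼ x₂ → z ∼ x₆ → ¬ dist z ≤ 3 → Square
      common-neighbour {z} z∼x₂ z∼x₆ far with Any.any? (z ≟V_) corners
      ... | no z∉C = ⊥-elim (C6-free (hexagon
            z∼x₂ (∼-sym e₁) (∼-sym e₀) (∼-sym e₇) (∼-sym e₆) (∼-sym z∼x₆)
            (z∉C ∘ there ∘ here) (z∉C ∘ there ∘ there ∘ there ∘ there ∘ there ∘ there ∘ there ∘ here)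
            x₁≢x₇ (≢-sym x₀≢x₂) x₂≢x₆ x₀≢x₆))
      ... | yes (here refl) = ⊥-elim (far (dist-minimal (Within-+ 2 (Within-∼ refl (∼-sym x₀∼w)))))
      ... | yes (there (here refl)) = ⊥-elim (far (dist-minimal (Within-+ 1 w⇝x₁)))
      ... | yes (there (there (here refl))) = ⊥-elim (∼⇒≢ z∼x₂ refl)
      ... | yes (there (there (there (here refl)))) = square e₃ e₄ e₅ (∼-sym z∼x₆) x₃≢x₅ x₄≢x₆
      ... | yes (there (there (there (there (here refl))))) = ⊥-elim (∼⇒side≢ z∼x₂ (∼∼-side e₂ e₃))
      ... | yes (there (there (there (there (there (here refl)))))) = square e₂ e₃ e₄ z∼x₂ x₂≢x₄ x₃≢x₅
      ... | yes (there (there (there (there (there (there (here refl))))))) = ⊥-elim (∼⇒≢ z∼x₆ refl)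
      ... | yes (there (there (there (there (there (there (there (here refl)))))))) =
        ⊥-elim (far (dist-minimal (Within-+ 1 w⇝x₇)))

      far-case : Certificate ⊎ Square
      far-case with peak₂ | peak₆
      ... | peak-at φ _ (inj₁ low) | _ = inj₂ (fork⇒square w φ low)
      ... | _ | peak-at φ _ (inj₁ low) = inj₂ (fork⇒square w φ low)
      ... | peak-at {z} φ _ (inj₂ z∼x₂) | peak-at {z′} φ′ _ (inj₂ z′∼x₆) with z ≟V z′
      ...   | no z≢z′ = inj₁ (w , two-forks φ φ′ z≢z′)
      ...   | yes refl with dist z ≤? 3
      ...     | yes low = inj₂ (fork⇒square w φ low)
      ...     | no far = inj₂ (common-neighbour z∼x₂ z′∼x₆ far)

    certificate-or-square : Certificate ⊎ Square
    certificate-or-square with w ∼? x₂ | w ∼? x₆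
    ... | yes w∼x₂ | _ = inj₂ (square (∼-sym x₀∼w) e₀ e₁ (∼-sym w∼x₂) w≢x₁ x₀≢x₂)
    ... | no _ | yes w∼x₆ = inj₂ (square (∼-sym x₀∼w) (∼-sym e₇) (∼-sym e₆) (∼-sym w∼x₆) w≢x₇ x₀≢x₆)
    ... | no ¬w∼x₂ | no ¬w∼x₆ = far-case ¬w∼x₂ ¬w∼x₆

  anchored-octagon⇒certificate : ∀ {w} → AnchoredOctagon w → Certificate ⊎ Square
  anchored-octagon⇒certificate (C , x₀∼w , w∉C) = AtOctagon.certificate-or-square C x₀∼w w∉C

  exit-from : ∀ {xs u v} → u ∈ xs → side u ≢ side v → v ∉ xs → Exit xs
  exit-from {xs} {u} {v} u∈ u≁v v∉ with u ∼? v
  ... | yes e = v , Any.map (λ { refl → e }) u∈ , ¬Any⇒All¬ xs v∉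
  ... | no ¬e = leave (nonadjacent⇒path₅ u≁v ¬e) u∈ v∉

  exit : ∀ {x y} xs → length xs < 10 → x ∼ y → x ∈ xs → y ∈ xs → Exit xs
  exit {x} xs |xs|<10 x∼y x∈ y∈ with ∃-∉V xs (≤-trans |xs|<10 (+-mono-≤ 5≤n₁ 5≤n₂))
  ... | v , v∉ with side x Data.Bool.≟ side v
  ...   | no x≁v = exit-from x∈ x≁v v∉
  ...   | yes x≈v = exit-from y∈ (λ y≈v → ∼⇒side≢ x∼y (trans x≈v (sym y≈v))) v∉

  square⇒certificate : Square → Certificate
  square⇒certificate C
    with exit (Square.corners C) (from-yes (4 <? 10)) (Square.e₀ C) (here refl) (there (here refl))
  ... | w , x∼w , w∉C = anchored-square⇒certificate (anchor□ C x∼w w∉C)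

  octagon⇒certificate : Octagon → Certificate ⊎ Square
  octagon⇒certificate C
    with exit (Octagon.corners C) (from-yes (8 <? 10)) (Octagon.e₀ C) (here refl) (there (here refl))
  ... | w , x∼w , w∉C = anchored-octagon⇒certificate (anchor⁸ C x∼w w∉C)

  grid-nonedge : ∃₂ λ i j → H (pick₁ i) (pick₂ j) ≡ false
  grid-nonedge with any? (λ i → any? (λ j → H (pick₁ i) (pick₂ j) Data.Bool.≟ false))
  ... | yes (i , j , Hij) = i , j , Hij
  ... | no none = ⊥-elim (C6-free (hexagon
        (e 0F 0F) (∼-sym (e 1F 0F)) (e 1F 1F) (∼-sym (e 2F 1F)) (e 2F 2F) (∼-sym (e 0F 2F))
        (a≢ 0F 1F λ ()) (a≢ 0F 2F λ ()) (a≢ 1F 2F λ ()) (b≢ 0F 1F λ ()) (b≢ 0F 2F λ ()) (b≢ 1F 2F λ ())))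
    where
    e : ∀ i j → inj₁ (pick₁ i) ∼ inj₂ (pick₂ j)
    e i j = edge (≢false⇒T λ Hij → none (i , j , Hij))
    a≢ : ∀ i j → i ≢ j → inj₁ {B = Fin n₂} (pick₁ i) ≢ inj₁ (pick₁ j)
    a≢ i j i≢j eq = i≢j (inject≤-injective 5≤n₁ 5≤n₁ i j (inj₁-injective eq))
    b≢ : ∀ i j → i ≢ j → inj₂ {A = Fin n₁} (pick₂ i) ≢ inj₂ (pick₂ j)
    b≢ i j i≢j eq = i≢j (inject≤-injective 5≤n₂ 5≤n₂ i j (inj₂-injective eq))

  -- The closed walk u x₁ x₂ x₃ y₄ y₃ y₂ y₁ is an octagon unless its two halves meet, and every way
  -- in which they can meet yields a square or a hexagon.
  path₃+path₅ : ∀ {u x₁ x₂ x₃} → u ∼ x₁ → x₁ ∼ x₂ → x₂ ∼ x₃ → u ≢ x₂ → x₁ ≢ x₃ → Path₅ u x₃ →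
                Square ⊎ Octagon
  path₃+path₅ {u} {x₁} {x₂} {x₃} f₀ f₁ f₂ u≢x₂ x₁≢x₃
    (path₅ {y₁} {y₂} {y₃} {y₄} e₀ e₁ e₂ e₃ e₄ u≢y₂ u≢y₄ y₂≢y₄ y₁≢y₃ y₁≢x₃ y₃≢x₃)
    with x₁ ≟V y₃ | x₁ ≟V y₁ | x₂ ≟V y₂ | x₂ ≟V y₄
  ... | yes refl | _ | _ | _ = inj₁ (square e₀ e₁ e₂ (∼-sym f₀) u≢y₂ y₁≢y₃)
  ... | no _ | yes refl | yes refl | _ = inj₁ (square e₂ e₃ e₄ (∼-sym f₂) y₂≢y₄ y₃≢x₃)
  ... | no _ | yes refl | no _ | yes refl = inj₁ (square e₁ e₂ e₃ (∼-sym f₁) y₁≢y₃ y₂≢y₄)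
  ... | no _ | yes refl | no x₂≢y₂ | no x₂≢y₄ = ⊥-elim (C6-free (hexagon
        f₁ f₂ (∼-sym e₄) (∼-sym e₃) (∼-sym e₂) (∼-sym e₁)
        x₁≢x₃ y₁≢y₃ (≢-sym y₃≢x₃) x₂≢y₄ x₂≢y₂ (≢-sym y₂≢y₄)))
  ... | no _ | no x₁≢y₁ | yes refl | _ = inj₁ (square e₀ e₁ (∼-sym f₁) (∼-sym f₀) u≢y₂ (≢-sym x₁≢y₁))
  ... | no x₁≢y₃ | no x₁≢y₁ | no _ | yes refl = ⊥-elim (C6-free (hexagon
        e₀ e₁ e₂ e₃ (∼-sym f₁) (∼-sym f₀) u≢y₂ u≢y₄ y₂≢y₄ y₁≢y₃ (≢-sym x₁≢y₁) (≢-sym x₁≢y₃)))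
  ... | no x₁≢y₃ | no x₁≢y₁ | no x₂≢y₂ | no x₂≢y₄ = inj₂ (octagon
        e₀ e₁ e₂ e₃ e₄ (∼-sym f₂) (∼-sym f₁) (∼-sym f₀)
        u≢y₂ u≢y₄ u≢x₂ y₂≢y₄ (≢-sym x₂≢y₂) (≢-sym x₂≢y₄)
        y₁≢y₃ y₁≢x₃ (≢-sym x₁≢y₁) y₃≢x₃ (≢-sym x₁≢y₃) (≢-sym x₁≢x₃))

  square-or-octagon : Square ⊎ Octagon
  square-or-octagon with grid-nonedge
  ... | i , j , Hij with nonedge⇒path₅ Hij
  ...   | path₅ {x₁} {x₂} {x₃} e₀ e₁ e₂ _ _ u≢x₂ _ _ x₁≢x₃ _ _ with inj₁ (pick₁ i) ∼? x₃
  ...     | yes u∼x₃ = inj₁ (square e₀ e₁ e₂ (∼-sym u∼x₃) u≢x₂ x₁≢x₃)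
  ...     | no ¬u∼x₃ = path₃+path₅ e₀ e₁ e₂ u≢x₂ x₁≢x₃ (nonadjacent⇒path₅ (∼∼∼⇒side≢ e₀ e₁ e₂) ¬u∼x₃)

  certificate : Certificate
  certificate = [ square⇒certificate , [ id , square⇒certificate ]′ ∘ octagon⇒certificate ]′ square-or-octagon

proposition2p4 : (n₁ n₂ : ℕ) → 5 ≤ n₁ → 5 ≤ n₂ →
    (H : SpanningSub n₁ n₂) → C6Saturated H → n₁ + n₂ + 1 ≤ edgeCount H
proposition2p4 n₁ n₂ 5≤n₁ 5≤n₂ H (C6-free , saturated) = certificate⇒edgeCount certificate
  where open Saturated H C6-free saturated 5≤n₁ 5≤n₂
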